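{- Let $\mathcal{E}$ be a Boolean equation system and $f,f',f''$ proposition formulae. Writing $\simeq$ for bisimilarity of structure graphs, the following hold: $\langle\mathcal{E},(f\wedge f')\wedge f''\rangle\simeq\langle\mathcal{E},f\wedge(f'\wedge f'')\rangle$; $\langle\mathcal{E},(f\vee f')\vee f''\rangle\simeq\langle\mathcal{E},f\vee(f'\vee f'')\rangle$; $\langle\mathcal{E},f\wedge f'\rangle\simeq\langle\mathcal{E},f'\wedge f\rangle$; $\langle\mathcal{E},f\vee f'\rangle\simeq\langle\mathcal{E},f'\vee f\rangle$; $\langle\mathcal{E},(f\wedge f)\wedge f'\rangle\simeq\langle\mathcal{E},f\wedge f'\rangle$; $\langle\mathcal{E},(f\vee f)\vee f'\rangle\simeq\langle\mathcal{E},f\vee f'\rangle$.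
   Context: Proposition formulae: $f::=\mathsf{true}\mid\mathsf{false}\mid X\mid f\wedge f\mid f\vee f$ with $X$ a proposition variable. A Boolean equation system (BES) is a finite sequence $\mathcal{E}=(\sigma_1X_1=f_1)\cdots(\sigma_nX_n=f_n)$, $\sigma_i\in\{\mu,\nu\}$, $X_i$ pairwise distinct; $\mathsf{bnd}(\mathcal{E})=\{X_1,\dots,X_n\}$. The rank of a bound variable: $\mathsf{rank}_{(\sigma Y=f)\mathcal{E}}(X)=\mathsf{rank}_{\mathcal{E}}(X)$ if $X\neq Y$ and $=\mathsf{block}_\sigma(\mathcal{E})$ if $X=Y$, where $\mathsf{block}_\sigma(\epsilon)=0$ if $\sigma=\nu$ and $1$ if $\sigma=\mu$, and $\mathsf{block}_\sigma((\sigma'Y=f)\mathcal{E})=\mathsf{block}_\sigma(\mathcal{E})$ if $\sigma=\sigma'$ and $1+\mathsf{block}_{\sigma'}(\mathcal{E})$ otherwise. A structure graph is a tuple $\langle T,t,\to,d,r,\nearrow\rangle$: vertex set $T$, root $t\in T$, edge relation $\to\subseteq T\times T$, partial decoration map $d:T\to\{\blacktriangle,\blacktriangledown,\top,\bot\}$, partial rank map $r:T\to\mathbb{N}$, partial free-variable map $\nearrow$ into proposition variables. A relation $R$ between vertices of two structure graphs is a bisimulation if for all $(u,u')\in R$: $d(u)=d'(u')$, $r(u)=r'(u')$, $\nearrow(u)=\nearrow'(u')$ (each meaning: both undefined, or both defined and equal), every edge $u\to v$ is matched by some $u'\to v'$ with $(v,v')\in R$, and vice versa. Structure graphs are bisimilar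 if some bisimulation relates their roots. For a BES $\mathcal{E}$, the structure graph on vertices $\langle\mathcal{E},g\rangle$ ($g$ a formula) is defined as follows. $\langle\mathcal{E},X\rangle$ has free-variable label $X$ iff $X\notin\mathsf{bnd}(\mathcal{E})$, and rank $\mathsf{rank}_{\mathcal{E}}(X)$ iff $X\in\mathsf{bnd}(\mathcal{E})$; no other vertex has a rank or free-variable label. Decorations: $\langle\mathcal{E},\mathsf{true}\rangle$ is $\top$, $\langle\mathcal{E},\mathsf{false}\rangle$ is $\bot$, $\langle\mathcal{E},g\wedge g'\rangle$ is $\blacktriangle$, $\langle\mathcal{E},g\vee g'\rangle$ is $\blacktriangledown$; for $X\in\mathsf{bnd}(\mathcal{E})$ with equation $\sigma X=g$, $\langle\mathcal{E},X\rangle$ is $\blacktriangle$ if $g$ is a conjunction, $\blacktriangledown$ if $g$ is a disjunction, undecorated otherwise; other vertices are undecorated. Edges: for each operand $h$ of $g\wedge g'$, if $h$ is itself a conjunction then $\langle\mathcal{E},g\wedge g'\rangle$ has edges to all successors of $\langle\mathcal{E},h\rangle$, otherwise it has an edge to $\langle\mathcal{E},h\rangle$; symmetrically for $g\vee g'$ with "disjunction". For $X\in\mathsf{bnd}(\mathcal{E})$ with equation $\sigma X=g$: if $g$ is a conjunction or disjunction, $\langle\mathcal{E},X\rangle$ has edges to all successors of $\langle\mathcal{E},g\rangle$; otherwise a single edge to $\langle\mathcal{E},g\rangle$. Vertices for $\mathsf{true}$, $\mathsf{false}$ and free variables have no edges. $\langle\mathcal{E},f\rangle$ denotes the structure graph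 of the vertices reachable from $\langle\mathcal{E},f\rangle$, rooted there. -}

module Defs where

open import Data.Nat using (ℕ; zero; suc; _≟_)
open import Data.List using (List; []; _∷_; map)
open import Data.List.Relation.Unary.Unique.Propositional using (Unique)
open import Data.Maybe using (Maybe; just; nothing)
open import Data.Product using (Σ; ∃; _×_; _,_; proj₁)
open import Data.Empty using (⊥)
open import Data.Unit using (⊤)
open import Relation.Nullary using (yes; no; ¬_)
open import Relation.Binary.PropositionalEquality using (_≡_)
open import Relation.Binary.Construct.Closure.ReflexiveTransitive using (Star; ε)

PVar : Set
PVar = ℕ

data Form : Set where
  tt ff : Form
  var   : PVar → Form
  _∧_ _∨_ : Form → Form → Form

infixr 6 _∧_
infixr 5 _∨_

data Fix : Set where
  μ ν : Fix

record Eqn : Set where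
  constructor eqn
  field
    σ   : Fix
    lhs : PVar
    rhs : Form
open Eqn public

BES : Set
BES = List Eqn

bndList : BES → List PVar
bndList = map lhs

WellFormed : BES → Set
WellFormed E = Unique (bndList E)

eqnOf : BES → PVar → Maybe (Fix × Form)
eqnOf [] X = nothing
eqnOf (eqn s Y g ∷ E) X with X ≟ Y
... | yes _ = just (s , g)
... | no  _ = eqnOf E X

block : Fix → BES → ℕ
block ν [] = 0
block μ [] = 1
block μ (eqn μ _ _ ∷ E) = block μ E
block ν (eqn ν _ _ ∷ E) = block ν E
block μ (eqn ν _ _ ∷ E) = suc (block ν E)
block ν (eqn μ _ _ ∷ E) = suc (block μ E)

rank : BES → PVar → Maybe ℕ
rank [] X = nothing
rank (eqn s Y g ∷ E) X with X ≟ Y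
... | yes _ = just (block s E)
... | no  _ = rank E X

data Deco : Set where
  ▲ ▼ top bot : Deco

IsConj : Form → Set
IsConj (_ ∧ _) = ⊤
IsConj _ = ⊥

IsDisj : Form → Set
IsDisj (_ ∨ _) = ⊤
IsDisj _ = ⊥

record StructureGraph : Set₁ where
  field
    T     : Set
    root  : T
    _⟶_   : T → T → Set
    d     : T → Maybe Deco
    r     : T → Maybe ℕ
    fv    : T → Maybe PVar

record IsBisimulation (G G' : StructureGraph)
       (R : StructureGraph.T G → StructureGraph.T G' → Set) : Set where
  module G  = StructureGraph G
  module G' = StructureGraph G'
  field
    deco  : ∀ {u u'} → R u u' → G.d u ≡ G'.d u'
    rnk   : ∀ {u u'} → R u u' → G.r u ≡ G'.r u'
    free  : ∀ {u u'} → R u u' → G.fv u ≡ G'.fv u'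
    forth : ∀ {u u' v} → R u u' → G._⟶_ u v →
            Σ G'.T (λ v' → G'._⟶_ u' v' × R v v')
    back  : ∀ {u u' v'} → R u u' → G'._⟶_ u' v' →
            Σ G.T (λ v → G._⟶_ u v × R v v')

_≃_ : StructureGraph → StructureGraph → Set₁
G ≃ G' = Σ (StructureGraph.T G → StructureGraph.T G' → Set) λ R →
           IsBisimulation G G' R × R (StructureGraph.root G) (StructureGraph.root G')

-- The structure graph of a BES; vertex ⟨E , g⟩ is represented by g.

data Edge (E : BES) : Form → Form → Set where
  ∧ˡ-flat : ∀ {g g' v} → IsConj g → Edge E g v → Edge E (g ∧ g') v
  ∧ˡ      : ∀ {g g'} → ¬ IsConj g → Edge E (g ∧ g') g
  ∧ʳ-flat : ∀ {g g' v} → IsConj g' → Edge E g' v → Edge E (g ∧ g') v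
  ∧ʳ      : ∀ {g g'} → ¬ IsConj g' → Edge E (g ∧ g') g'
  ∨ˡ-flat : ∀ {g g' v} → IsDisj g → Edge E g v → Edge E (g ∨ g') v
  ∨ˡ      : ∀ {g g'} → ¬ IsDisj g → Edge E (g ∨ g') g
  ∨ʳ-flat : ∀ {g g' v} → IsDisj g' → Edge E g' v → Edge E (g ∨ g') v
  ∨ʳ      : ∀ {g g'} → ¬ IsDisj g' → Edge E (g ∨ g') g'
  var-∧   : ∀ {X s g v} → eqnOf E X ≡ just (s , g) → IsConj g →
            Edge E g v → Edge E (var X) v
  var-∨   : ∀ {X s g v} → eqnOf E X ≡ just (s , g) → IsDisj g →
            Edge E g v → Edge E (var X) v
  var-1   : ∀ {X s g} → eqnOf E X ≡ just (s , g) → ¬ IsConj g → ¬ IsDisj g →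
            Edge E (var X) g

decoRhs : Maybe (Fix × Form) → Maybe Deco
decoRhs (just (_ , (_ ∧ _))) = just ▲
decoRhs (just (_ , (_ ∨ _))) = just ▼
decoRhs _ = nothing

decoOf : BES → Form → Maybe Deco
decoOf E tt = just top
decoOf E ff = just bot
decoOf E (_ ∧ _) = just ▲
decoOf E (_ ∨ _) = just ▼
decoOf E (var X) = decoRhs (eqnOf E X)

rankOf : BES → Form → Maybe ℕ
rankOf E (var X) = rank E X
rankOf E _ = nothing

fvRhs : PVar → Maybe (Fix × Form) → Maybe PVar
fvRhs X nothing = just X
fvRhs X (just _) = nothing

fvOf : BES → Form → Maybe PVar
fvOf E (var X) = fvRhs X (eqnOf E X)
fvOf E _ = nothing

⟨_,_⟩ : BES → Form → StructureGraph
⟨ E , f ⟩ = record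
  { T    = Σ Form (Star (Edge E) f)
  ; root = f , ε
  ; _⟶_  = λ u v → Edge E (proj₁ u) (proj₁ v)
  ; d    = λ u → decoOf E (proj₁ u)
  ; r    = λ u → rankOf E (proj₁ u)
  ; fv   = λ u → fvOf E (proj₁ u)
  }

module Submission where

-- A vertex ⟨E, g ∘ h⟩ (∘ ∈ {∧, ∨}) has no rank and no
-- free-variable label, and its decoration is determined by ∘.  So two such
-- vertices built with the same connective are bisimilar as soon as they have
-- the same SET of successors: relate the two roots to each other and every
-- other reachable vertex to itself.
--
-- The successor set of g ∘ h is the union of the contributions of its two
-- operands, where an operand that is itself a ∘-formula contributes its own
-- successors (flattening) and any other operand contributes itself.  Applied
-- to a nested operand this gives "contributions of g ∘ h = contributions of g
-- ∪ contributions of h".  Associativity, commutativity and idempotence of the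
-- connectives therefore reduce to the same laws for union of predicates.

open import Defs
open import Level using (0ℓ)
open import Data.Product using (_×_; _,_; Σ; proj₁; proj₂)
open import Data.Sum using (_⊎_; inj₁; inj₂)
open import Data.Empty using (⊥-elim)
open import Data.Unit using (tt)
open import Relation.Nullary using (¬_)
open import Relation.Binary.PropositionalEquality using (_≡_; refl)
open import Relation.Binary.Construct.Closure.ReflexiveTransitive using (Star; ε; _◅_; _◅◅_)
open import Relation.Unary using (Pred; _⊆_; _≐_; _∪_)
open import Relation.Unary.Properties using (≐-refl; ≐-trans)
open import Relation.Unary.Algebra using (∪-cong; ∪-comm; ∪-assoc; ∪-idem)
open import Relation.Unary.Relation.Binary.Equality using (≐-setoid)
import Relation.Binary.Reasoning.Setoid as SetoidReasoning

module ≐-Reasoning = SetoidReasoning (≐-setoid Form 0ℓ)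

Reach : BES → Form → Set
Reach E a = Σ Form (Star (Edge E) a)

_⊳_ : ∀ {E a w} (u : Reach E a) → Edge E (proj₁ u) w → Reach E a
u ⊳ e = _ , proj₂ u ◅◅ (e ◅ ε)

module _ (E : BES) where

  data RootsOrEqual (a b : Form) : Reach E a → Reach E b → Set where
    same  : ∀ {x p q} → RootsOrEqual a b (x , p) (x , q)
    roots : ∀ {p q}   → RootsOrEqual a b (a , p) (b , q)

  -- The relation is symmetric up to swapping the two graphs; this turns the
  -- forth condition into the back condition.
  flip-related : ∀ {a b u u'} → RootsOrEqual a b u u' → RootsOrEqual b a u' u
  flip-related same  = same
  flip-related roots = roots

  label-agrees : ∀ {A : Set} {a b} (label : Form → A) → label a ≡ label b →
    ∀ {u u'} → RootsOrEqual a b u u' → label (proj₁ u) ≡ label (proj₁ u')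
  label-agrees _ _  same  = refl
  label-agrees _ eq roots = eq

  match-edge : ∀ {a b} → Edge E a ⊆ Edge E b →
    ∀ {u u' v} → RootsOrEqual a b u u' → Edge E (proj₁ u) (proj₁ v) →
    Σ (Reach E b) λ v' → Edge E (proj₁ u') (proj₁ v') × RootsOrEqual a b v v'
  match-edge _   {u' = u'} same  e = u' ⊳ e , e , same
  match-edge a⊆b {u' = u'} roots e = u' ⊳ a⊆b e , a⊆b e , same

  same-successors⇒≃ : ∀ {a b} →
    decoOf E a ≡ decoOf E b → rankOf E a ≡ rankOf E b → fvOf E a ≡ fvOf E b →
    Edge E a ≐ Edge E b → ⟨ E , a ⟩ ≃ ⟨ E , b ⟩
  same-successors⇒≃ {a} {b} same-deco same-rank same-fv (a⊆b , b⊆a) =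
    RootsOrEqual a b , isBisimulation , roots
    where
    isBisimulation : IsBisimulation ⟨ E , a ⟩ ⟨ E , b ⟩ (RootsOrEqual a b)
    isBisimulation = record
      { deco  = label-agrees (decoOf E) same-deco
      ; rnk   = label-agrees (rankOf E) same-rank
      ; free  = label-agrees (fvOf E) same-fv
      ; forth = match-edge a⊆b
      ; back  = λ related e →
          let v , e' , related' = match-edge b⊆a (flip-related related) e
          in  v , e' , flip-related related'
      }

-- The two binary connectives, so that every law is stated once for both.
data Connective : Set where
  conj disj : Connective

_⟪_⟫_ : Form → Connective → Form → Form
g ⟪ conj ⟫ h = g ∧ h
g ⟪ disj ⟫ h = g ∨ h

Is : Connective → Form → Set
Is conj = IsConj
Is disj = IsDisj

is-compound : ∀ c g h → Is c (g ⟪ c ⟫ h)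
is-compound conj _ _ = tt
is-compound disj _ _ = tt

Operand : BES → Connective → Form → Pred Form 0ℓ
Operand E c g v = (Is c g × Edge E g v) ⊎ (¬ Is c g × v ≡ g)

compound-successors : ∀ E c g h →
  Edge E (g ⟪ c ⟫ h) ≐ Operand E c g ∪ Operand E c h
compound-successors E conj g h = split , join
  where
  split : Edge E (g ∧ h) ⊆ Operand E conj g ∪ Operand E conj h
  split (∧ˡ-flat i e) = inj₁ (inj₁ (i , e))
  split (∧ˡ n)        = inj₁ (inj₂ (n , refl))
  split (∧ʳ-flat i e) = inj₂ (inj₁ (i , e))
  split (∧ʳ n)        = inj₂ (inj₂ (n , refl))
  join : Operand E conj g ∪ Operand E conj h ⊆ Edge E (g ∧ h)
  join (inj₁ (inj₁ (i , e)))    = ∧ˡ-flat i e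
  join (inj₁ (inj₂ (n , refl))) = ∧ˡ n
  join (inj₂ (inj₁ (i , e)))    = ∧ʳ-flat i e
  join (inj₂ (inj₂ (n , refl))) = ∧ʳ n
compound-successors E disj g h = split , join
  where
  split : Edge E (g ∨ h) ⊆ Operand E disj g ∪ Operand E disj h
  split (∨ˡ-flat i e) = inj₁ (inj₁ (i , e))
  split (∨ˡ n)        = inj₁ (inj₂ (n , refl))
  split (∨ʳ-flat i e) = inj₂ (inj₁ (i , e))
  split (∨ʳ n)        = inj₂ (inj₂ (n , refl))
  join : Operand E disj g ∪ Operand E disj h ⊆ Edge E (g ∨ h)
  join (inj₁ (inj₁ (i , e)))    = ∨ˡ-flat i e
  join (inj₁ (inj₂ (n , refl))) = ∨ˡ n
  join (inj₂ (inj₁ (i , e)))    = ∨ʳ-flat i e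
  join (inj₂ (inj₂ (n , refl))) = ∨ʳ n

compound-operand : ∀ E c g h → Operand E c (g ⟪ c ⟫ h) ≐ Edge E (g ⟪ c ⟫ h)
compound-operand E c g h = contributed , (λ e → inj₁ (is-compound c g h , e))
  where
  contributed : Operand E c (g ⟪ c ⟫ h) ⊆ Edge E (g ⟪ c ⟫ h)
  contributed (inj₁ (_ , e)) = e
  contributed (inj₂ (n , _)) = ⊥-elim (n (is-compound c g h))

flatten : ∀ E c g h → Operand E c (g ⟪ c ⟫ h) ≐ Operand E c g ∪ Operand E c h
flatten E c g h = ≐-trans (compound-operand E c g h) (compound-successors E c g h)

module _ (E : BES) (c : Connective) where
  open ≐-Reasoning

  private
    _∘_ : Form → Form → Form
    g ∘ h = g ⟪ c ⟫ h

    op : Form → Pred Form 0ℓ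
    op = Operand E c

  successors-assoc : ∀ f f' f'' → Edge E ((f ∘ f') ∘ f'') ≐ Edge E (f ∘ (f' ∘ f''))
  successors-assoc f f' f'' = begin
    Edge E ((f ∘ f') ∘ f'')  ≈⟨ compound-successors E c (f ∘ f') f'' ⟩
    op (f ∘ f') ∪ op f''     ≈⟨ ∪-cong (flatten E c f f') ≐-refl ⟩
    (op f ∪ op f') ∪ op f''  ≈⟨ ∪-assoc (op f) (op f') (op f'') ⟩
    op f ∪ (op f' ∪ op f'')  ≈⟨ ∪-cong ≐-refl (flatten E c f' f'') ⟨
    op f ∪ op (f' ∘ f'')     ≈⟨ compound-successors E c f (f' ∘ f'') ⟨
    Edge E (f ∘ (f' ∘ f''))  ∎

  successors-comm : ∀ f f' → Edge E (f ∘ f') ≐ Edge E (f' ∘ f)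
  successors-comm f f' = begin
    Edge E (f ∘ f')  ≈⟨ compound-successors E c f f' ⟩
    op f ∪ op f'     ≈⟨ ∪-comm (op f) (op f') ⟩
    op f' ∪ op f     ≈⟨ compound-successors E c f' f ⟨
    Edge E (f' ∘ f)  ∎

  successors-idem : ∀ f f' → Edge E ((f ∘ f) ∘ f') ≐ Edge E (f ∘ f')
  successors-idem f f' = begin
    Edge E ((f ∘ f) ∘ f')  ≈⟨ compound-successors E c (f ∘ f) f' ⟩
    op (f ∘ f) ∪ op f'     ≈⟨ ∪-cong (flatten E c f f) ≐-refl ⟩
    (op f ∪ op f) ∪ op f'  ≈⟨ ∪-cong (∪-idem (op f)) ≐-refl ⟩
    op f ∪ op f'           ≈⟨ compound-successors E c f f' ⟨
    Edge E (f ∘ f')        ∎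

-- Two c-formulae with the same successors are bisimilar: they carry the same
-- decoration and neither has a rank or a free-variable label.
compound-≃ : ∀ E c {g h g' h'} →
  Edge E (g ⟪ c ⟫ h) ≐ Edge E (g' ⟪ c ⟫ h') → ⟨ E , g ⟪ c ⟫ h ⟩ ≃ ⟨ E , g' ⟪ c ⟫ h' ⟩
compound-≃ E conj = same-successors⇒≃ E refl refl refl
compound-≃ E disj = same-successors⇒≃ E refl refl refl

lemma3p5 : (E : BES) → WellFormed E → (f f' f'' : Form) →
    (⟨ E , (f ∧ f') ∧ f'' ⟩ ≃ ⟨ E , f ∧ (f' ∧ f'') ⟩)
    × (⟨ E , (f ∨ f') ∨ f'' ⟩ ≃ ⟨ E , f ∨ (f' ∨ f'') ⟩)
    × (⟨ E , f ∧ f' ⟩ ≃ ⟨ E , f' ∧ f ⟩)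
    × (⟨ E , f ∨ f' ⟩ ≃ ⟨ E , f' ∨ f ⟩)
    × (⟨ E , (f ∧ f) ∧ f' ⟩ ≃ ⟨ E , f ∧ f' ⟩)
    × (⟨ E , (f ∨ f) ∨ f' ⟩ ≃ ⟨ E , f ∨ f' ⟩)
lemma3p5 E _ f f' f'' =
    compound-≃ E conj (successors-assoc E conj f f' f'')
  , compound-≃ E disj (successors-assoc E disj f f' f'')
  , compound-≃ E conj (successors-comm E conj f f')
  , compound-≃ E disj (successors-comm E disj f f')
  , compound-≃ E conj (successors-idem E conj f f')
  , compound-≃ E disj (successors-idem E disj f f')
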